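{- Let $p \le q$ be positive integers. Then $\gamma_{\mathrm{aut}}(K_p \times K_q) = p$.
   Context: $K_p\times K_q$ denotes the Cartesian product of complete graphs: vertices are pairs $(i,j)$, $0\le i<p$, $0\le j<q$, with $(i,j)$ adjacent to $(i',j')$ iff they agree in exactly one coordinate. For a finite simple graph $G=(V,E)$: two dominating sets $S,S'$ are adjacent if there are $v\in S$, $v'\in S'$ with $vv'\in E$ and $S'=(S\setminus\{v\})\cup\{v'\}$. A collection $\mathcal{F}$ of subsets of $V$ is an autonomously dominating family if: (1) every member is a dominating set; (2) for each $S\in\mathcal{F}$ and each $v\in V\setminus S$ there is $S'\in\mathcal{F}$ adjacent to $S$ with $v\in S'$; (3) for each $S\in\mathcal{F}$, every dominating set adjacent to $S$ belongs to $\mathcal{F}$. An autonomous dominating set is a member of some autonomously dominating family; $\gamma_{\mathrm{aut}}(G)$ is the least size of an autonomous dominating set. -}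

module Defs where

open import Data.Nat using (ℕ; _*_)
open import Data.Fin using (Fin; remQuot)
open import Data.Fin.Subset using (Subset; _∈_; _∉_; _∪_; _-_; ⁅_⁆; ∣_∣)
open import Data.Product using (Σ; ∃; ∃-syntax; _×_; _,_; proj₁; proj₂)
open import Data.Sum using (_⊎_)
open import Relation.Binary.PropositionalEquality using (_≡_; _≢_)

-- Cartesian product K_p × K_q.  Vertex x : Fin (p * q) encodes the pair
-- remQuot q x = (i , j) with i : Fin p, j : Fin q (a bijection).
-- (i,j) ~ (i',j') iff they agree in exactly one coordinate.
KAdj : (p q : ℕ) → Fin (p * q) → Fin (p * q) → Set
KAdj p q x y =
  let i  = proj₁ (remQuot {p} q x) ; j  = proj₂ (remQuot {p} q x)
      i' = proj₁ (remQuot {p} q y) ; j' = proj₂ (remQuot {p} q y)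
  in (i ≡ i' × j ≢ j') ⊎ (i ≢ i' × j ≡ j')

module _ {n : ℕ} (Adj : Fin n → Fin n → Set) where

  Dominating : Subset n → Set
  Dominating S = ∀ v → v ∈ S ⊎ (∃[ u ] (u ∈ S × Adj u v))

  AdjacentSets : Subset n → Subset n → Set
  AdjacentSets S S' = ∃[ v ] ∃[ v' ]
    (v ∈ S × v' ∈ S' × Adj v v' × S' ≡ ((S - v) ∪ ⁅ v' ⁆))

  record IsAutDomFamily (𝓕 : Subset n → Set) : Set where
    field
      dominating : ∀ S → 𝓕 S → Dominating S
      reach      : ∀ S → 𝓕 S → ∀ v → v ∉ S →
                   ∃[ S' ] (𝓕 S' × AdjacentSets S S' × v ∈ S')
      closed     : ∀ S S' → 𝓕 S → Dominating S' → AdjacentSets S S' → 𝓕 S'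

  AutonomousDominating : Subset n → Set₁
  AutonomousDominating S = Σ (Subset n → Set) λ 𝓕 → IsAutDomFamily 𝓕 × 𝓕 S

  GammaAutIs : ℕ → Set₁
  GammaAutIs k = (∃[ S ] (AutonomousDominating S × ∣ S ∣ ≡ k))
               × (∀ S → AutonomousDominating S → k Data.Nat.≤ ∣ S ∣)

-- A dominating set S of K_p × K_q meets every row or every column: if row i
-- is missed, each vertex (i , j) can only be dominated through column j.
-- Either way S has a representative in each line of one direction, so
-- |S| ≥ min (p , q) = p, and the first column is a dominating set of size p.
-- The dominating sets of size at most p form an autonomously dominating
-- family: an exchange never grows a set, and to bring in a vertex v ∉ S one
-- exchanges it for the representative of its row (or column), which is
-- adjacent to v and keeps every line of that direction represented.
module Submission where

open import Defs
open import Data.Nat using (ℕ; zero; suc; _≤_; _+_; _*_; z≤n; s≤s)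
open import Data.Nat.Properties using (≤-trans; ≤-antisym; ≤-reflexive; +-comm; +-suc; +-monoʳ-≤; module ≤-Reasoning)
open import Data.Fin as Fin using (Fin; remQuot; combine; fromℕ<)
open import Data.Fin.Properties using (remQuot-combine; combine-remQuot; suc-injective; ¬∀⟶∃¬; all?; any?)
open import Data.Fin.Subset using (Subset; _∈_; _∉_; _∪_; _-_; ⁅_⁆; ∣_∣; ⊥; inside; outside)
open import Data.Fin.Subset.Properties
open import Data.Vec using (_∷_; [])
open import Data.Product using (∃-syntax; _×_; _,_; proj₁; proj₂)
open import Data.Sum using (_⊎_; inj₁; inj₂)
open import Function using (_∘_)
open import Function.Definitions using (Injective)
open import Relation.Binary.PropositionalEquality
open import Relation.Nullary using (Dec; yes; no)
open import Relation.Nullary.Decidable using (_×-dec_)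
open import Data.Empty using (⊥-elim)

∣p∪q∣≤∣p∣+∣q∣ : ∀ {n} (p q : Subset n) → ∣ p ∪ q ∣ ≤ ∣ p ∣ + ∣ q ∣
∣p∪q∣≤∣p∣+∣q∣ []            []            = z≤n
∣p∪q∣≤∣p∣+∣q∣ (inside ∷ p)  (x ∷ q)       =
  s≤s (≤-trans (∣p∪q∣≤∣p∣+∣q∣ p q) (+-monoʳ-≤ ∣ p ∣ (∣p∣≤∣x∷p∣ x q)))
∣p∪q∣≤∣p∣+∣q∣ (outside ∷ p) (inside ∷ q)
  rewrite +-suc ∣ p ∣ ∣ q ∣ = s≤s (∣p∪q∣≤∣p∣+∣q∣ p q)
∣p∪q∣≤∣p∣+∣q∣ (outside ∷ p) (outside ∷ q) = ∣p∪q∣≤∣p∣+∣q∣ p q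

exchange : ∀ {n} → Subset n → Fin n → Fin n → Subset n
exchange S u v = (S - u) ∪ ⁅ v ⁆

∣exchange∣≤∣p∣ : ∀ {n} {S : Subset n} {u} v → u ∈ S → ∣ exchange S u v ∣ ≤ ∣ S ∣
∣exchange∣≤∣p∣ {S = S} {u} v u∈S = ≤-trans (∣p∪q∣≤∣p∣+∣q∣ (S - u) ⁅ v ⁆) (begin
  ∣ S - u ∣ + ∣ ⁅ v ⁆ ∣  ≡⟨ cong (∣ S - u ∣ +_) (∣⁅x⁆∣≡1 v) ⟩
  ∣ S - u ∣ + 1          ≡⟨ +-comm ∣ S - u ∣ 1 ⟩
  suc ∣ S - u ∣          ≤⟨ x∈p⇒∣p-x∣<∣p∣ u∈S ⟩
  ∣ S ∣                  ∎)
  where open ≤-Reasoning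

v∈exchange : ∀ {n} (S : Subset n) u v → v ∈ exchange S u v
v∈exchange S u v = q⊆p∪q (S - u) ⁅ v ⁆ (x∈⁅x⁆ v)

∈exchange : ∀ {n} {S : Subset n} {u w} v → w ∈ S → w ≢ u → w ∈ exchange S u v
∈exchange v w∈S w≢u = p⊆p∪q ⁅ v ⁆ (x∈p∧x≢y⇒x∈p-y w∈S w≢u)

image : ∀ {m n} → (Fin m → Fin n) → Subset n
image {zero}  f = ⊥
image {suc m} f = ⁅ f Fin.zero ⁆ ∪ image (f ∘ Fin.suc)

∣image∣≤m : ∀ {m n} (f : Fin m → Fin n) → ∣ image f ∣ ≤ m
∣image∣≤m {zero}  {n} f = ≤-reflexive (∣⊥∣≡0 n)
∣image∣≤m {suc m} f = ≤-trans (∣p∪q∣≤∣p∣+∣q∣ ⁅ f Fin.zero ⁆ (image (f ∘ Fin.suc)))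
  (subst (λ k → k + ∣ image (f ∘ Fin.suc) ∣ ≤ suc m) (sym (∣⁅x⁆∣≡1 (f Fin.zero)))
    (s≤s (∣image∣≤m (f ∘ Fin.suc))))

∈image : ∀ {m n} (f : Fin m → Fin n) i → f i ∈ image f
∈image {suc m} f Fin.zero    = p⊆p∪q (image (f ∘ Fin.suc)) (x∈⁅x⁆ (f Fin.zero))
∈image {suc m} f (Fin.suc i) = q⊆p∪q ⁅ f Fin.zero ⁆ (image (f ∘ Fin.suc)) (∈image (f ∘ Fin.suc) i)

injective⇒≤∣p∣ : ∀ {m n} (S : Subset n) (f : Fin m → Fin n) →
                 Injective _≡_ _≡_ f → (∀ i → f i ∈ S) → m ≤ ∣ S ∣
injective⇒≤∣p∣ {zero}  S f _   _   = z≤n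
injective⇒≤∣p∣ {suc m} S f inj f∈S = ≤-trans
  (s≤s (injective⇒≤∣p∣ (S - f Fin.zero) (f ∘ Fin.suc) (suc-injective ∘ inj)
    (λ i → x∈p∧x≢y⇒x∈p-y (f∈S (Fin.suc i)) (λ e → suc≢zero (inj e)))))
  (x∈p⇒∣p-x∣<∣p∣ (f∈S Fin.zero))
  where
  suc≢zero : ∀ {i : Fin m} → Fin.suc i ≢ Fin.zero
  suc≢zero ()

module _ {n k : ℕ} (π : Fin n → Fin k) where

  HitsFibres : Subset n → Set
  HitsFibres S = ∀ i → ∃[ u ] (u ∈ S × π u ≡ i)

  hitsFibre? : ∀ S i → Dec (∃[ u ] (u ∈ S × π u ≡ i))
  hitsFibre? S i = any? (λ u → (u ∈? S) ×-dec (π u Fin.≟ i))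

  hitsFibres⇒k≤∣p∣ : ∀ {S} → HitsFibres S → k ≤ ∣ S ∣
  hitsFibres⇒k≤∣p∣ {S} hits = injective⇒≤∣p∣ S (proj₁ ∘ hits)
    (λ {i} {j} e → trans (sym (proj₂ (proj₂ (hits i)))) (trans (cong π e) (proj₂ (proj₂ (hits j)))))
    (proj₁ ∘ proj₂ ∘ hits)

  hitsFibres-exchange : ∀ {S u} v → HitsFibres S → π u ≡ π v → HitsFibres (exchange S u v)
  hitsFibres-exchange {S} {u} v hits πu≡πv i with hits i
  ... | w , w∈S , πw≡i with w Fin.≟ u
  ...   | yes refl = v , v∈exchange S u v , trans (sym πu≡πv) πw≡i
  ...   | no w≢u   = w , ∈exchange v w∈S w≢u , πw≡i

module RookGraph (p q : ℕ) where

  V : Set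
  V = Fin (p * q)

  row : V → Fin p
  row x = proj₁ (remQuot {p} q x)

  col : V → Fin q
  col x = proj₂ (remQuot {p} q x)

  G : V → V → Set
  G = KAdj p q

  row-col-injective : ∀ {u v} → row u ≡ row v → col u ≡ col v → u ≡ v
  row-col-injective {u} {v} r c =
    trans (sym (combine-remQuot {p} q u)) (trans (cong₂ (combine {p}) r c) (combine-remQuot {p} q v))

  row-combine : ∀ i j → row (combine i j) ≡ i
  row-combine i j = cong proj₁ (remQuot-combine {p} i j)

  col-combine : ∀ i j → col (combine i j) ≡ j
  col-combine i j = cong proj₂ (remQuot-combine {p} i j)

  Small : Subset (p * q) → Set
  Small S = Dominating G S × ∣ S ∣ ≤ p

  -- Rows and columns play symmetric roles: π picks the line, σ the position on it.
  module Lines {k l} (π : V → Fin k) (σ : V → Fin l)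
               (π-σ-injective : ∀ {u v} → π u ≡ π v → σ u ≡ σ v → u ≡ v)
               (adjacent : ∀ {u v} → π u ≡ π v → σ u ≢ σ v → G u v) where

    hitsFibres⇒dominating : ∀ {S} → HitsFibres π S → Dominating G S
    hitsFibres⇒dominating {S} hits v with hits (π v)
    ... | u , u∈S , πu≡πv with σ u Fin.≟ σ v
    ...   | yes σu≡σv = inj₁ (subst (_∈ S) (π-σ-injective πu≡πv σu≡σv) u∈S)
    ...   | no σu≢σv  = inj₂ (u , u∈S , adjacent πu≡πv σu≢σv)

    reach : ∀ {S} → Small S → HitsFibres π S → ∀ v → v ∉ S →
            ∃[ S' ] (Small S' × AdjacentSets G S S' × v ∈ S')
    reach {S} (_ , ∣S∣≤p) hits v v∉S with hits (π v)
    ... | u , u∈S , πu≡πv =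
      exchange S u v ,
      (hitsFibres⇒dominating (hitsFibres-exchange π v hits πu≡πv) , ≤-trans (∣exchange∣≤∣p∣ v u∈S) ∣S∣≤p) ,
      (u , v , u∈S , v∈exchange S u v , adjacent πu≡πv σu≢σv , refl) ,
      v∈exchange S u v
      where
      σu≢σv : σ u ≢ σ v
      σu≢σv σu≡σv = v∉S (subst (_∈ S) (π-σ-injective πu≡πv σu≡σv) u∈S)

  module Rows = Lines row col row-col-injective (λ r c → inj₁ (r , c))
  module Cols = Lines col row (λ c r → row-col-injective r c) (λ c r → inj₂ (r , c))

  dominating⇒hitsRows⊎hitsCols : ∀ {S} → Dominating G S → HitsFibres row S ⊎ HitsFibres col S
  dominating⇒hitsRows⊎hitsCols {S} dom with all? (hitsFibre? row S)
  ... | yes hitsRows = inj₁ hitsRows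
  ... | no ¬hitsRows with ¬∀⟶∃¬ p _ (hitsFibre? row S) ¬hitsRows
  ...   | i , rowMissed = inj₂ λ j → throughColumn j (dom (combine i j))
    where
    throughColumn : ∀ j → combine i j ∈ S ⊎ ∃[ u ] (u ∈ S × G u (combine i j)) →
                    ∃[ u ] (u ∈ S × col u ≡ j)
    throughColumn j (inj₁ ij∈S)                     = ⊥-elim (rowMissed (combine i j , ij∈S , row-combine i j))
    throughColumn j (inj₂ (u , u∈S , inj₁ (r , _))) = ⊥-elim (rowMissed (u , u∈S , trans r (row-combine i j)))
    throughColumn j (inj₂ (u , u∈S , inj₂ (_ , c))) = u , u∈S , trans c (col-combine i j)

  dominating⇒p≤∣S∣ : p ≤ q → ∀ {S} → Dominating G S → p ≤ ∣ S ∣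
  dominating⇒p≤∣S∣ p≤q dom with dominating⇒hitsRows⊎hitsCols dom
  ... | inj₁ hitsRows = hitsFibres⇒k≤∣p∣ row hitsRows
  ... | inj₂ hitsCols = ≤-trans p≤q (hitsFibres⇒k≤∣p∣ col hitsCols)

  small-reach : ∀ {S} → Small S → ∀ v → v ∉ S → ∃[ S' ] (Small S' × AdjacentSets G S S' × v ∈ S')
  small-reach small with dominating⇒hitsRows⊎hitsCols (proj₁ small)
  ... | inj₁ hitsRows = Rows.reach small hitsRows
  ... | inj₂ hitsCols = Cols.reach small hitsCols

  small-closed : ∀ {S S'} → Small S → Dominating G S' → AdjacentSets G S S' → Small S'
  small-closed (_ , ∣S∣≤p) dom' (u , v , u∈S , _ , _ , refl) = dom' , ≤-trans (∣exchange∣≤∣p∣ v u∈S) ∣S∣≤p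

  small-isAutDomFamily : IsAutDomFamily G Small
  small-isAutDomFamily = record
    { dominating = λ _ → proj₁
    ; reach      = λ _ → small-reach
    ; closed     = λ _ _ → small-closed
    }

  firstColumnVertex : 1 ≤ q → Fin p → V
  firstColumnVertex 1≤q i = combine i (fromℕ< 1≤q)

  firstColumn : 1 ≤ q → Subset (p * q)
  firstColumn 1≤q = image (firstColumnVertex 1≤q)

  firstColumn-small : (1≤q : 1 ≤ q) → Small (firstColumn 1≤q)
  firstColumn-small 1≤q =
    Rows.hitsFibres⇒dominating
      (λ i → firstColumnVertex 1≤q i , ∈image (firstColumnVertex 1≤q) i , row-combine i (fromℕ< 1≤q)) ,
    ∣image∣≤m (firstColumnVertex 1≤q)

mainTheorem4 : (p q : ℕ) → 1 ≤ p → p ≤ q → GammaAutIs (KAdj p q) p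
mainTheorem4 p q 1≤p p≤q =
  (S₀ , (Small , small-isAutDomFamily , S₀-small) , ≤-antisym (proj₂ S₀-small) (dominating⇒p≤∣S∣ p≤q (proj₁ S₀-small))) ,
  λ S (𝓕 , isFamily , S∈𝓕) → dominating⇒p≤∣S∣ p≤q (IsAutDomFamily.dominating isFamily S S∈𝓕)
  where
  open RookGraph p q
  S₀ : Subset (p * q)
  S₀ = firstColumn (≤-trans 1≤p p≤q)
  S₀-small : Small S₀
  S₀-small = firstColumn-small (≤-trans 1≤p p≤q)
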